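{- Let $G$ be a graph and $I$ a critical independent set of $G$. Then: (i) if there exists $S\subseteq N(I)$ with $|N(S)\cap I|=|S|$, then $I\setminus N(S)$ is a critical independent set of $G$; (ii) if $S\subseteq N(I)$ is a set of maximum cardinality such that $|N(S)\cap I|=|S|$, then $I\setminus N(S)=\ker(G)$.
   Context: All graphs are finite and simple. For $S\subseteq V(G)$, $N(S)$ is the set of vertices adjacent to some vertex of $S$. Let $d(G)=\max\{|S|-|N(S)|: S\subseteq V(G)\}$. A critical independent set is an independent set $S$ with $|S|-|N(S)|=d(G)$. $\ker(G)$ is the intersection of all critical independent sets of $G$. -}

module Defs where

open import Data.Bool using (Bool; true; false; _∧_; _∨_)
open import Data.Nat using (ℕ; zero; suc)
open import Data.Fin using (Fin; zero; suc)
open import Data.Fin.Subset using (Subset; _∈_; _⊆_; _∩_; _─_; ∣_∣)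
open import Data.Vec using (tabulate; lookup)
open import Data.Integer using (ℤ; _-_; _≤_; +_)
open import Data.Product using (_×_)
open import Relation.Binary.PropositionalEquality using (_≡_)

record Graph (n : ℕ) : Set where
  field
    adj   : Fin n → Fin n → Bool
    sym   : ∀ u v → adj u v ≡ adj v u
    irrefl : ∀ v → adj v v ≡ false
open Graph public

anyFin : ∀ {n} → (Fin n → Bool) → Bool
anyFin {zero}  p = false
anyFin {suc n} p = p zero ∨ anyFin (λ i → p (suc i))

N : ∀ {n} → Graph n → Subset n → Subset n
N G S = tabulate (λ v → anyFin (λ u → lookup S u ∧ adj G u v))

surplus : ∀ {n} → Graph n → Subset n → ℤ
surplus G S = + ∣ S ∣ - + ∣ N G S ∣

Independent : ∀ {n} → Graph n → Subset n → Set
Independent G S = ∀ u v → u ∈ S → v ∈ S → adj G u v ≡ false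

AttainsD : ∀ {n} → Graph n → Subset n → Set
AttainsD G S = ∀ T → surplus G T ≤ surplus G S

CriticalIndependent : ∀ {n} → Graph n → Subset n → Set
CriticalIndependent G S = Independent G S × AttainsD G S

InKer : ∀ {n} → Graph n → Fin n → Set
InKer G v = ∀ J → CriticalIndependent G J → v ∈ J

Matched : ∀ {n} → Graph n → Subset n → Subset n → Set
Matched G I S = ∣ N G S ∩ I ∣ ≡ ∣ S ∣

{-# OPTIONS --safe #-}
-- Put K = I ─ N(S). Then N(K) ⊆ N(I) avoids S and ∣I∣ = ∣K∣ + ∣N(S) ∩ I∣, so counting gives
-- surplus K ≥ surplus I + ∣S∣ − ∣N(S) ∩ I∣. For matched S this makes K critical, which is (i);
-- for K = I ─ N(T) with arbitrary T ⊆ N(I), criticality of I turns it into Hall's condition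
-- ∣T∣ ≤ ∣N(T) ∩ I∣.
-- For (ii), N is submodular, so the surplus is supermodular and surplus (K ∩ J) ≥ surplus K for
-- every critical J. With K' = K ∩ J, the set T = S ∪ (N(K) ─ N(K')) is again matched (Hall gives
-- one inequality, counting inside I the other) and ∣T∣ − ∣S∣ ≥ ∣N(K)∣ − ∣N(K')∣ ≥ ∣K∣ − ∣K'∣.
-- Maximality of S therefore forces K' = K, i.e. K ⊆ J.
module Submission where

open import Defs
open import Data.Nat using (ℕ; _≤_)
open import Data.Fin using (Fin)
open import Data.Fin.Subset using (Subset; _∈_; _⊆_; _─_; ∣_∣)
open import Data.Product using (_×_)
open import Function.Bundles using (_⇔_)

open import Data.Bool using (Bool; true; false; _∧_; _∨_)
open import Data.Bool.Properties using (∨-zeroʳ; ∧-conicalˡ; ∧-conicalʳ)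
open import Data.Empty using (⊥-elim)
open import Data.Fin using (zero; suc)
open import Data.Fin.Subset using (inside; outside; _∉_; _⊂_; _∪_; _∩_; Empty)
open import Data.Fin.Subset.Properties
  using (_∈?_; p⊆q⇒∣p∣≤∣q∣; p⊂q⇒∣p∣<∣q∣; ∣⊥∣≡0; Empty-unique; ∣p∩q∣≤∣p∣;
         p⊆p∪q; q⊆p∪q; x∈p∪q⁺; x∈p∪q⁻; p∩q⊆p; p∩q⊆q; x∈p∩q⁺; x∈p∩q⁻; p─q⊆p)
import Data.Integer as ℤ
import Data.Integer.Properties as ℤₚ
open import Data.Integer.Tactic.RingSolver using (solve-∀)
import Data.Nat as ℕ
open import Data.Nat using (_+_)
open import Data.Nat.Properties as ℕₚ
  using (+-suc; +-identityʳ; +-assoc; +-comm; +-monoˡ-≤; +-monoʳ-≤; +-mono-≤; +-monoʳ-<;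
         +-cancelˡ-≤; +-cancelʳ-≤; ≤-antisym; ≤-trans; ≤-reflexive; <⇒≱; module ≤-Reasoning)
open import Algebra.Properties.CommutativeSemigroup ℕₚ.+-commutativeSemigroup
  using (interchange; x∙yz≈xz∙y; xy∙z≈xz∙y)
open import Data.Product using (_,_; proj₁; proj₂; uncurry; ∃-syntax)
open import Data.Sum using ([_,_]; map)
open import Data.Vec using (_∷_; []; here; there)
open import Data.Vec.Properties using (lookup∘tabulate; []=⇒lookup; lookup⇒[]=)
open import Function using (_∘_)
open import Function.Bundles using (mk⇔; Equivalence)
open import Relation.Binary.PropositionalEquality as ≡ using (_≡_; refl; trans; cong; cong₂; subst)
open import Relation.Nullary using (yes; no)

private
  variable
    n : ℕ
    x : Fin n

open Equivalence using (to; from)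
open ≤-Reasoning

Disjoint : Subset n → Subset n → Set
Disjoint p q = ∀ {x} → x ∈ p → x ∉ q

Disjoint-sym : ∀ {p q : Subset n} → Disjoint p q → Disjoint q p
Disjoint-sym p#q x∈q x∈p = p#q x∈p x∈q

x∈p─q⇒x∉q : ∀ (p q : Subset n) → x ∈ p ─ q → x ∉ q
x∈p─q⇒x∉q (inside ∷ p) (outside ∷ q) here ()
x∈p─q⇒x∉q (_ ∷ p) (_ ∷ q) (there x∈p─q) (there x∈q) = x∈p─q⇒x∉q p q x∈p─q x∈q

∪-lub : ∀ {p q r : Subset n} → p ⊆ r → q ⊆ r → p ∪ q ⊆ r
∪-lub {p = p} {q} p⊆r q⊆r = [ p⊆r , q⊆r ] ∘ x∈p∪q⁻ p q

∣p∪q∣+∣p∩q∣≡∣p∣+∣q∣ : ∀ (p q : Subset n) → ∣ p ∪ q ∣ + ∣ p ∩ q ∣ ≡ ∣ p ∣ + ∣ q ∣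
∣p∪q∣+∣p∩q∣≡∣p∣+∣q∣ []            []            = refl
∣p∪q∣+∣p∩q∣≡∣p∣+∣q∣ (inside  ∷ p) (inside  ∷ q) = cong ℕ.suc (begin-equality
  ∣ p ∪ q ∣ + ℕ.suc ∣ p ∩ q ∣   ≡⟨ +-suc ∣ p ∪ q ∣ ∣ p ∩ q ∣ ⟩
  ℕ.suc (∣ p ∪ q ∣ + ∣ p ∩ q ∣) ≡⟨ cong ℕ.suc (∣p∪q∣+∣p∩q∣≡∣p∣+∣q∣ p q) ⟩
  ℕ.suc (∣ p ∣ + ∣ q ∣)         ≡⟨ +-suc ∣ p ∣ ∣ q ∣ ⟨
  ∣ p ∣ + ℕ.suc ∣ q ∣           ∎)
∣p∪q∣+∣p∩q∣≡∣p∣+∣q∣ (inside  ∷ p) (outside ∷ q) = cong ℕ.suc (∣p∪q∣+∣p∩q∣≡∣p∣+∣q∣ p q)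
∣p∪q∣+∣p∩q∣≡∣p∣+∣q∣ (outside ∷ p) (inside  ∷ q) =
  trans (cong ℕ.suc (∣p∪q∣+∣p∩q∣≡∣p∣+∣q∣ p q)) (≡.sym (+-suc ∣ p ∣ ∣ q ∣))
∣p∪q∣+∣p∩q∣≡∣p∣+∣q∣ (outside ∷ p) (outside ∷ q) = ∣p∪q∣+∣p∩q∣≡∣p∣+∣q∣ p q

∣p─q∣+∣q∩p∣≡∣p∣ : ∀ (p q : Subset n) → ∣ p ─ q ∣ + ∣ q ∩ p ∣ ≡ ∣ p ∣
∣p─q∣+∣q∩p∣≡∣p∣ []            []            = refl
∣p─q∣+∣q∩p∣≡∣p∣ (inside  ∷ p) (inside  ∷ q) =
  trans (+-suc ∣ p ─ q ∣ ∣ q ∩ p ∣) (cong ℕ.suc (∣p─q∣+∣q∩p∣≡∣p∣ p q))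
∣p─q∣+∣q∩p∣≡∣p∣ (inside  ∷ p) (outside ∷ q) = cong ℕ.suc (∣p─q∣+∣q∩p∣≡∣p∣ p q)
∣p─q∣+∣q∩p∣≡∣p∣ (outside ∷ p) (inside  ∷ q) = ∣p─q∣+∣q∩p∣≡∣p∣ p q
∣p─q∣+∣q∩p∣≡∣p∣ (outside ∷ p) (outside ∷ q) = ∣p─q∣+∣q∩p∣≡∣p∣ p q

Disjoint⇒∣p∩q∣≡0 : ∀ {p q : Subset n} → Disjoint p q → ∣ p ∩ q ∣ ≡ 0
Disjoint⇒∣p∩q∣≡0 {n} {p} {q} p#q = trans (cong ∣_∣ (Empty-unique p∩q-empty)) (∣⊥∣≡0 n)
  where
  p∩q-empty : Empty (p ∩ q)
  p∩q-empty (_ , x∈p∩q) = uncurry p#q (x∈p∩q⁻ p q x∈p∩q)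

Disjoint⇒∣p∣+∣q∣≤∣r∣ : ∀ {p q r : Subset n} → Disjoint p q → p ⊆ r → q ⊆ r → ∣ p ∣ + ∣ q ∣ ≤ ∣ r ∣
Disjoint⇒∣p∣+∣q∣≤∣r∣ {p = p} {q} {r} p#q p⊆r q⊆r = begin
  ∣ p ∣ + ∣ q ∣         ≡⟨ ∣p∪q∣+∣p∩q∣≡∣p∣+∣q∣ p q ⟨
  ∣ p ∪ q ∣ + ∣ p ∩ q ∣ ≡⟨ cong (∣ p ∪ q ∣ +_) (Disjoint⇒∣p∩q∣≡0 p#q) ⟩
  ∣ p ∪ q ∣ + 0         ≡⟨ +-identityʳ ∣ p ∪ q ∣ ⟩
  ∣ p ∪ q ∣             ≤⟨ p⊆q⇒∣p∣≤∣q∣ (∪-lub p⊆r q⊆r) ⟩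
  ∣ r ∣                 ∎

anyFin⁺ : ∀ (p : Fin n → Bool) x → p x ≡ true → anyFin p ≡ true
anyFin⁺ p zero    px = cong (_∨ anyFin (p ∘ suc)) px
anyFin⁺ p (suc x) px = trans (cong (p zero ∨_) (anyFin⁺ (p ∘ suc) x px)) (∨-zeroʳ (p zero))

anyFin⁻ : ∀ (p : Fin n → Bool) → anyFin p ≡ true → ∃[ x ] p x ≡ true
anyFin⁻ {ℕ.suc n} p any with p zero in p0
... | true  = zero , p0
... | false with anyFin⁻ (p ∘ suc) any
...   | x , px = suc x , px

+a-+b≤+c-+d⇔a+d≤c+b : ∀ a b c d → (ℤ.+ a ℤ.- ℤ.+ b ℤ.≤ ℤ.+ c ℤ.- ℤ.+ d) ⇔ (a + d ≤ c + b)
+a-+b≤+c-+d⇔a+d≤c+b a b c d = mk⇔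
  (λ le → ℤₚ.drop‿+≤+ (ℤₚ.0≤i-j⇒j≤i (subst (ℤ.0ℤ ℤ.≤_) difference (ℤₚ.i≤j⇒0≤j-i le))))
  (λ le → ℤₚ.0≤i-j⇒j≤i (subst (ℤ.0ℤ ℤ.≤_) (≡.sym difference) (ℤₚ.i≤j⇒0≤j-i (ℤ.+≤+ le))))
  where
  ring : ∀ i j k l → (k ℤ.- l) ℤ.- (i ℤ.- j) ≡ (k ℤ.+ j) ℤ.- (i ℤ.+ l)
  ring = solve-∀
  difference : (ℤ.+ c ℤ.- ℤ.+ d) ℤ.- (ℤ.+ a ℤ.- ℤ.+ b) ≡ ℤ.+ (c + b) ℤ.- ℤ.+ (a + d)
  difference = trans (ring (ℤ.+ a) (ℤ.+ b) (ℤ.+ c) (ℤ.+ d))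
                     (≡.sym (cong₂ ℤ._-_ (ℤₚ.pos-+ c b) (ℤₚ.pos-+ a d)))

module _ (G : Graph n) where

  ∈N⁺ : ∀ {S : Subset n} {x y} → x ∈ S → adj G x y ≡ true → y ∈ N G S
  ∈N⁺ {S} {x} {y} x∈S xy = lookup⇒[]= y (N G S)
    (trans (lookup∘tabulate _ y) (anyFin⁺ _ x (cong₂ _∧_ ([]=⇒lookup x∈S) xy)))

  ∈N⁻ : ∀ {S : Subset n} {y} → y ∈ N G S → ∃[ x ] x ∈ S × adj G x y ≡ true
  ∈N⁻ {S} {y} y∈NS with anyFin⁻ _ (trans (≡.sym (lookup∘tabulate _ y)) ([]=⇒lookup y∈NS))
  ... | x , Sx∧xy = x , lookup⇒[]= x S (∧-conicalˡ _ _ Sx∧xy) , ∧-conicalʳ _ _ Sx∧xy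

  N-mono : ∀ {S T : Subset n} → S ⊆ T → N G S ⊆ N G T
  N-mono S⊆T y∈NS with ∈N⁻ y∈NS
  ... | x , x∈S , xy = ∈N⁺ (S⊆T x∈S) xy

  N-∪ : ∀ (S T : Subset n) → N G (S ∪ T) ⊆ N G S ∪ N G T
  N-∪ S T y∈N with ∈N⁻ y∈N
  ... | x , x∈S∪T , xy = x∈p∪q⁺ (map (λ x∈S → ∈N⁺ x∈S xy) (λ x∈T → ∈N⁺ x∈T xy) (x∈p∪q⁻ S T x∈S∪T))

  N-∩ : ∀ (S T : Subset n) → N G (S ∩ T) ⊆ N G S ∩ N G T
  N-∩ S T y∈N = x∈p∩q⁺ (N-mono (p∩q⊆p S T) y∈N , N-mono (p∩q⊆q S T) y∈N)

  Disjoint-N : ∀ {S T : Subset n} → Disjoint S (N G T) → Disjoint (N G S) T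
  Disjoint-N S#NT y∈NS y∈T with ∈N⁻ y∈NS
  ... | x , x∈S , xy = S#NT x∈S (∈N⁺ y∈T (trans (Graph.sym G _ _) xy))

  N-submodular : ∀ (S T : Subset n) → ∣ N G (S ∪ T) ∣ + ∣ N G (S ∩ T) ∣ ≤ ∣ N G S ∣ + ∣ N G T ∣
  N-submodular S T = begin
    ∣ N G (S ∪ T) ∣ + ∣ N G (S ∩ T) ∣     ≤⟨ +-mono-≤ (p⊆q⇒∣p∣≤∣q∣ (N-∪ S T)) (p⊆q⇒∣p∣≤∣q∣ (N-∩ S T)) ⟩
    ∣ N G S ∪ N G T ∣ + ∣ N G S ∩ N G T ∣ ≡⟨ ∣p∪q∣+∣p∩q∣≡∣p∣+∣q∣ (N G S) (N G T) ⟩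
    ∣ N G S ∣ + ∣ N G T ∣                 ∎

  surplus≤surplus⇔ : ∀ (S T : Subset n) →
    surplus G S ℤ.≤ surplus G T ⇔ ∣ S ∣ + ∣ N G T ∣ ≤ ∣ T ∣ + ∣ N G S ∣
  surplus≤surplus⇔ S T = +a-+b≤+c-+d⇔a+d≤c+b (∣ S ∣) (∣ N G S ∣) (∣ T ∣) (∣ N G T ∣)

  Independent-⊆ : ∀ {I K : Subset n} → Independent G I → K ⊆ I → Independent G K
  Independent-⊆ indI K⊆I u v u∈K v∈K = indI u v (K⊆I u∈K) (K⊆I v∈K)

  -- surplus (I ─ N T) ≥ surplus I + ∣ T ∣ − ∣ N T ∩ I ∣, rearranged to avoid subtraction.
  surplus-─N : ∀ {I T : Subset n} → T ⊆ N G I →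
    ∣ I ∣ + ∣ N G (I ─ N G T) ∣ + ∣ T ∣ ≤ ∣ I ─ N G T ∣ + ∣ N G I ∣ + ∣ N G T ∩ I ∣
  surplus-─N {I} {T} T⊆NI = begin
    ∣ I ∣ + ∣ N G K ∣ + ∣ T ∣         ≡⟨ +-assoc (∣ I ∣) _ _ ⟩
    ∣ I ∣ + (∣ N G K ∣ + ∣ T ∣)       ≤⟨ +-monoʳ-≤ (∣ I ∣) (Disjoint⇒∣p∣+∣q∣≤∣r∣ NK#T NK⊆NI T⊆NI) ⟩
    ∣ I ∣ + ∣ N G I ∣                 ≡⟨ cong (_+ ∣ N G I ∣) (∣p─q∣+∣q∩p∣≡∣p∣ I (N G T)) ⟨
    ∣ K ∣ + ∣ N G T ∩ I ∣ + ∣ N G I ∣ ≡⟨ xy∙z≈xz∙y (∣ K ∣) _ _ ⟩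
    ∣ K ∣ + ∣ N G I ∣ + ∣ N G T ∩ I ∣ ∎
    where
    K : Subset n
    K = I ─ N G T
    NK#T : Disjoint (N G K) T
    NK#T = Disjoint-N (x∈p─q⇒x∉q I (N G T))
    NK⊆NI : N G K ⊆ N G I
    NK⊆NI = N-mono (p─q⊆p I (N G T))

  AttainsD⇒∣T∣≤∣NT∩I∣ : ∀ {I T : Subset n} → AttainsD G I → T ⊆ N G I → ∣ T ∣ ≤ ∣ N G T ∩ I ∣
  AttainsD⇒∣T∣≤∣NT∩I∣ {I} {T} attI T⊆NI = +-cancelˡ-≤ (∣ I ∣ + ∣ N G K ∣) _ _ (begin
    ∣ I ∣ + ∣ N G K ∣ + ∣ T ∣         ≤⟨ surplus-─N T⊆NI ⟩
    ∣ K ∣ + ∣ N G I ∣ + ∣ N G T ∩ I ∣ ≤⟨ +-monoˡ-≤ _ (to (surplus≤surplus⇔ K I) (attI K)) ⟩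
    ∣ I ∣ + ∣ N G K ∣ + ∣ N G T ∩ I ∣ ∎)
    where
    K : Subset n
    K = I ─ N G T

  AttainsD-─N : ∀ {I S : Subset n} → AttainsD G I → S ⊆ N G I → Matched G I S →
    AttainsD G (I ─ N G S)
  AttainsD-─N {I} {S} attI S⊆NI matched T =
    ℤₚ.≤-trans (attI T) (from (surplus≤surplus⇔ I (I ─ N G S)) I≤K)
    where
    I≤K : ∣ I ∣ + ∣ N G (I ─ N G S) ∣ ≤ ∣ I ─ N G S ∣ + ∣ N G I ∣
    I≤K = +-cancelʳ-≤ (∣ S ∣) _ _
      (subst (∣ I ∣ + ∣ N G (I ─ N G S) ∣ + ∣ S ∣ ≤_) (cong (∣ I ─ N G S ∣ + ∣ N G I ∣ +_) matched)
        (surplus-─N S⊆NI))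

  CriticalIndependent-─N : ∀ {I S : Subset n} → CriticalIndependent G I → S ⊆ N G I →
    Matched G I S → CriticalIndependent G (I ─ N G S)
  CriticalIndependent-─N {I} {S} (indI , attI) S⊆NI matched =
    Independent-⊆ indI (p─q⊆p I (N G S)) , AttainsD-─N attI S⊆NI matched

  AttainsD⇒surplus≤surplus-∩ : ∀ {J : Subset n} → AttainsD G J → ∀ K →
    surplus G K ℤ.≤ surplus G (K ∩ J)
  AttainsD⇒surplus≤surplus-∩ {J} attJ K = from (surplus≤surplus⇔ K (K ∩ J))
    (+-cancelˡ-≤ (∣ J ∣ + ∣ N G (K ∪ J) ∣) _ _ (begin
      ∣ J ∣ + ∣ N G (K ∪ J) ∣ + (∣ K ∣ + ∣ N G (K ∩ J) ∣)
        ≡⟨ interchange (∣ J ∣) _ _ _ ⟩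
      ∣ J ∣ + ∣ K ∣ + (∣ N G (K ∪ J) ∣ + ∣ N G (K ∩ J) ∣)
        ≤⟨ +-mono-≤ (≤-reflexive (+-comm (∣ J ∣) _)) (N-submodular K J) ⟩
      ∣ K ∣ + ∣ J ∣ + (∣ N G K ∣ + ∣ N G J ∣)
        ≡⟨ cong (_+ (∣ N G K ∣ + ∣ N G J ∣)) (∣p∪q∣+∣p∩q∣≡∣p∣+∣q∣ K J) ⟨
      ∣ K ∪ J ∣ + ∣ K ∩ J ∣ + (∣ N G K ∣ + ∣ N G J ∣)
        ≡⟨ cong (∣ K ∪ J ∣ + ∣ K ∩ J ∣ +_) (+-comm (∣ N G K ∣) _) ⟩
      ∣ K ∪ J ∣ + ∣ K ∩ J ∣ + (∣ N G J ∣ + ∣ N G K ∣)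
        ≡⟨ interchange (∣ K ∪ J ∣) _ _ _ ⟩
      ∣ K ∪ J ∣ + ∣ N G J ∣ + (∣ K ∩ J ∣ + ∣ N G K ∣)
        ≤⟨ +-monoˡ-≤ _ (to (surplus≤surplus⇔ (K ∪ J) J) (attJ (K ∪ J))) ⟩
      ∣ J ∣ + ∣ N G (K ∪ J) ∣ + (∣ K ∩ J ∣ + ∣ N G K ∣) ∎))

  module Augmentation {I S K' : Subset n} (attI : AttainsD G I) (S⊆NI : S ⊆ N G I)
    (matched : Matched G I S) (K'⊆K : K' ⊆ I ─ N G S)
    (K≤K' : surplus G (I ─ N G S) ℤ.≤ surplus G K') where

    K : Subset n
    K = I ─ N G S

    D : Subset n
    D = N G K ─ N G K'

    T : Subset n
    T = S ∪ D

    K⊆I : K ⊆ I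
    K⊆I = p─q⊆p I (N G S)

    S#NK : Disjoint S (N G K)
    S#NK = Disjoint-sym (Disjoint-N (x∈p─q⇒x∉q I (N G S)))

    S#D : Disjoint S D
    S#D x∈S = S#NK x∈S ∘ p─q⊆p (N G K) (N G K')

    T⊆NI : T ⊆ N G I
    T⊆NI = ∪-lub S⊆NI (N-mono K⊆I ∘ p─q⊆p (N G K) (N G K'))

    T#NK' : Disjoint T (N G K')
    T#NK' x∈T = [ (λ x∈S → S#NK x∈S ∘ N-mono K'⊆K) , x∈p─q⇒x∉q (N G K) (N G K') ]
                  (x∈p∪q⁻ S D x∈T)

    ∣S∣+∣NK∣≤∣T∣+∣NK'∣ : ∣ S ∣ + ∣ N G K ∣ ≤ ∣ T ∣ + ∣ N G K' ∣
    ∣S∣+∣NK∣≤∣T∣+∣NK'∣ = begin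
      ∣ S ∣ + ∣ N G K ∣
        ≡⟨ cong (∣ S ∣ +_) (∣p─q∣+∣q∩p∣≡∣p∣ (N G K) (N G K')) ⟨
      ∣ S ∣ + (∣ D ∣ + ∣ N G K' ∩ N G K ∣)
        ≤⟨ +-monoʳ-≤ (∣ S ∣) (+-monoʳ-≤ (∣ D ∣) (∣p∩q∣≤∣p∣ (N G K') (N G K))) ⟩
      ∣ S ∣ + (∣ D ∣ + ∣ N G K' ∣)
        ≡⟨ +-assoc (∣ S ∣) _ _ ⟨
      ∣ S ∣ + ∣ D ∣ + ∣ N G K' ∣
        ≤⟨ +-monoˡ-≤ _ (Disjoint⇒∣p∣+∣q∣≤∣r∣ S#D (p⊆p∪q D) (q⊆p∪q S D)) ⟩
      ∣ T ∣ + ∣ N G K' ∣ ∎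

    ∣S∣+∣K∣≤∣T∣+∣K'∣ : ∣ S ∣ + ∣ K ∣ ≤ ∣ T ∣ + ∣ K' ∣
    ∣S∣+∣K∣≤∣T∣+∣K'∣ = +-cancelʳ-≤ (∣ N G K' ∣) _ _ (begin
      ∣ S ∣ + ∣ K ∣ + ∣ N G K' ∣   ≡⟨ +-assoc (∣ S ∣) _ _ ⟩
      ∣ S ∣ + (∣ K ∣ + ∣ N G K' ∣) ≤⟨ +-monoʳ-≤ (∣ S ∣) (to (surplus≤surplus⇔ K K') K≤K') ⟩
      ∣ S ∣ + (∣ K' ∣ + ∣ N G K ∣) ≡⟨ x∙yz≈xz∙y (∣ S ∣) _ _ ⟩
      ∣ S ∣ + ∣ N G K ∣ + ∣ K' ∣   ≤⟨ +-monoˡ-≤ (∣ K' ∣) ∣S∣+∣NK∣≤∣T∣+∣NK'∣ ⟩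
      ∣ T ∣ + ∣ N G K' ∣ + ∣ K' ∣  ≡⟨ xy∙z≈xz∙y (∣ T ∣) _ _ ⟩
      ∣ T ∣ + ∣ K' ∣ + ∣ N G K' ∣  ∎)

    ∣NT∩I∣≤∣T∣ : ∣ N G T ∩ I ∣ ≤ ∣ T ∣
    ∣NT∩I∣≤∣T∣ = +-cancelʳ-≤ (∣ K' ∣) _ _ (begin
      ∣ N G T ∩ I ∣ + ∣ K' ∣ ≤⟨ Disjoint⇒∣p∣+∣q∣≤∣r∣ NT∩I#K' (p∩q⊆q (N G T) I) (K⊆I ∘ K'⊆K) ⟩
      ∣ I ∣                  ≡⟨ ∣p─q∣+∣q∩p∣≡∣p∣ I (N G S) ⟨
      ∣ K ∣ + ∣ N G S ∩ I ∣  ≡⟨ cong (∣ K ∣ +_) matched ⟩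
      ∣ K ∣ + ∣ S ∣          ≡⟨ +-comm (∣ K ∣) _ ⟩
      ∣ S ∣ + ∣ K ∣          ≤⟨ ∣S∣+∣K∣≤∣T∣+∣K'∣ ⟩
      ∣ T ∣ + ∣ K' ∣         ∎)
      where
      NT∩I#K' : Disjoint (N G T ∩ I) K'
      NT∩I#K' x∈NT∩I = Disjoint-N T#NK' (proj₁ (x∈p∩q⁻ (N G T) I x∈NT∩I))

    Matched-T : Matched G I T
    Matched-T = ≤-antisym ∣NT∩I∣≤∣T∣ (AttainsD⇒∣T∣≤∣NT∩I∣ attI T⊆NI)

  ─N⊆AttainsD : ∀ {I S J : Subset n} → AttainsD G I → S ⊆ N G I → Matched G I S →
    (∀ T → T ⊆ N G I → Matched G I T → ∣ T ∣ ≤ ∣ S ∣) → AttainsD G J → I ─ N G S ⊆ J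
  ─N⊆AttainsD {I} {S} {J} attI S⊆NI matched maximum attJ {v} v∈K with v ∈? J
  ... | yes v∈J = v∈J
  ... | no  v∉J = ⊥-elim (<⇒≱ ∣S∣+∣K∩J∣<∣S∣+∣K∣ (≤-trans ∣S∣+∣K∣≤∣T∣+∣K'∣ ∣T∣+∣K∩J∣≤∣S∣+∣K∩J∣))
    where
    K : Subset n
    K = I ─ N G S
    open Augmentation attI S⊆NI matched (p∩q⊆p K J) (AttainsD⇒surplus≤surplus-∩ attJ K)
      using (T; T⊆NI; Matched-T; ∣S∣+∣K∣≤∣T∣+∣K'∣)
    K∩J⊂K : K ∩ J ⊂ K
    K∩J⊂K = p∩q⊆p K J , v , v∈K , v∉J ∘ proj₂ ∘ x∈p∩q⁻ K J
    ∣S∣+∣K∩J∣<∣S∣+∣K∣ : ∣ S ∣ + ∣ K ∩ J ∣ ℕ.< ∣ S ∣ + ∣ K ∣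
    ∣S∣+∣K∩J∣<∣S∣+∣K∣ = +-monoʳ-< (∣ S ∣) (p⊂q⇒∣p∣<∣q∣ K∩J⊂K)
    ∣T∣+∣K∩J∣≤∣S∣+∣K∩J∣ : ∣ T ∣ + ∣ K ∩ J ∣ ≤ ∣ S ∣ + ∣ K ∩ J ∣
    ∣T∣+∣K∩J∣≤∣S∣+∣K∩J∣ = +-monoˡ-≤ (∣ K ∩ J ∣) (maximum T T⊆NI Matched-T)

mainTheorem15 : ∀ {n} (G : Graph n) (I : Subset n) → CriticalIndependent G I →
    (∀ (S : Subset n) → S ⊆ N G I → Matched G I S → CriticalIndependent G (I ─ N G S))
    × (∀ (S : Subset n) → S ⊆ N G I → Matched G I S →
        (∀ (T : Subset n) → T ⊆ N G I → Matched G I T → ∣ T ∣ ≤ ∣ S ∣) →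
        ∀ (v : Fin n) → (v ∈ (I ─ N G S)) ⇔ InKer G v)
mainTheorem15 G I critI@(_ , attI) =
    (λ S S⊆NI matched → CriticalIndependent-─N G critI S⊆NI matched)
  , λ S S⊆NI matched maximum v → mk⇔
      (λ v∈K J (_ , attJ) → ─N⊆AttainsD G attI S⊆NI matched maximum attJ v∈K)
      (λ v∈ker → v∈ker (I ─ N G S) (CriticalIndependent-─N G critI S⊆NI matched))
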